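{- Let $G=(V,E)$ be a biconnected graph with positive node weights, let $s,t\in V$, and let $B$ be a minimum-weight $st$-NSC of $G$. Then both $s$ and $t$ are movable, and no other node of $B$ is movable.
   Context: An $st$-NSC is a connected subgraph $B$ of $G$ containing $s$ and $t$ such that $G-V(B)$ is connected and nonempty; its weight is the total weight of its nodes. For such $B$, $(V(B),V\setminus V(B))$ is a connected bipartition (both parts induce connected subgraphs). A node $v$ of $B$ is movable if moving $v$ to the other part, i.e. taking $(V(B)\setminus\{v\}, (V\setminus V(B))\cup\{v\})$, still gives a partition in which both parts induce connected subgraphs.
   Formalization: The positive node weights are rational. -}

module Defs where

open import Data.Nat using (ℕ)
open import Data.Fin using (Fin)
open import Data.Fin.Subset using (Subset; _∈_; ∁; _∪_; _-_; ⁅_⁆; Nonempty)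
open import Data.Bool using (true; false)
open import Data.Vec using (lookup)
open import Data.List using (foldr; map)
open import Data.List.Base using ()
open import Data.Fin.Base using ()
open import Data.List using (allFin)
open import Data.Rational using (ℚ; 0ℚ; _+_; _≤_; _<_)
open import Data.Product using (_×_; ∃)
open import Relation.Nullary using (¬_)
open import Relation.Binary.PropositionalEquality using (_≢_)

record Graph (n : ℕ) : Set₁ where
  field
    Adj   : Fin n → Fin n → Set
    sym   : ∀ {u v} → Adj u v → Adj v u
    irrefl : ∀ {u} → ¬ Adj u u
open Graph public

data WalkIn {n : ℕ} (G : Graph n) (S : Subset n) : Fin n → Fin n → Set where
  here : ∀ {u} → u ∈ S → WalkIn G S u u
  step : ∀ {u v w} → u ∈ S → Adj G u v → WalkIn G S v w → WalkIn G S u w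

-- S induces a connected subgraph of G (connected graphs are nonempty).
Connected : ∀ {n} → Graph n → Subset n → Set
Connected G S = Nonempty S × (∀ u v → u ∈ S → v ∈ S → WalkIn G S u v)

full : ∀ {n} → Subset n
full = ∁ Data.Fin.Subset.⊥

Biconnected : ∀ {n} → Graph n → Set
Biconnected {n} G = Connected G full × (∀ v → Connected G (full - v))

weight : ∀ {n} → (Fin n → ℚ) → Subset n → ℚ
weight {n} w S = foldr _+_ 0ℚ (map f (allFin n))
  where
  f : Fin n → ℚ
  f v with lookup S v
  ... | true  = w v
  ... | false = 0ℚ

-- B (given by its node set) is an st-NSC: connected, contains s and t,
-- and G - V(B) is connected and nonempty.
IsNSC : ∀ {n} → Graph n → Fin n → Fin n → Subset n → Set
IsNSC G s t B = s ∈ B × t ∈ B × Connected G B × Connected G (∁ B)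

IsMinNSC : ∀ {n} → Graph n → (Fin n → ℚ) → Fin n → Fin n → Subset n → Set
IsMinNSC G w s t B =
  IsNSC G s t B × (∀ B′ → IsNSC G s t B′ → weight w B ≤ weight w B′)

Movable : ∀ {n} → Graph n → Subset n → Fin n → Set
Movable G B v = v ∈ B × Connected G (B - v) × Connected G (∁ B ∪ ⁅ v ⁆)

-- Positive weights make a minimum-weight st-NSC B inclusion-minimal (no
-- st-NSC lies properly inside B).  An inner node v is then not movable, as
-- B - v would be such an st-NSC.  The end node s is movable by two facts:
--  (A) B - s is connected: with K the component of t in B - s, the set
--      K ∪ {s} is an st-NSC inside B (nodes of B outside it reach ∁B in
--      G - s without entering K), so it is all of B.
--  (B) s has a neighbour outside B: for x ∈ B - s let K x be the component
--      of s in B - x.  A path from s to ∁B in G - x leaves B at some z ∈ K x;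
--      if z ≠ s, minimality gives t ∉ K z and then K z ⊊ K x.  Descending
--      from x = t, the size of K x cannot shrink forever, so z = s eventually.
-- Components are computed as node subsets, which needs decidable adjacency,
-- so the argument runs in a finite skeleton of G (the edges of the walks
-- witnessing that B, ∁B and every G - x are connected) and is carried back.
module Submission where

open import Defs
open import Data.Nat using (_∸_) renaming (_<_ to _<ℕ_)
open import Data.Nat.Properties using (∸-monoʳ-<)
open import Data.Nat.Induction using (<-wellFounded)
open import Induction.WellFounded using (Acc; acc)
open import Data.Fin using (Fin; _≟_)
open import Data.Fin.Properties using (any?)
open import Data.Fin.Subset
  using (Subset; inside; outside; _∈_; _∉_; _⊆_; _⊂_; ∁; _∪_; _─_; _-_; ⁅_⁆; ∣_∣)
open import Data.Fin.Subset.Properties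
  using ( _∈?_; _⊂?_; x∈⁅x⁆; x∈⁅y⁆⇒x≡y; x∈∁p⇒x∉p; x∉p⇒x∈∁p; x∉∁p⇒x∈p
        ; p⊆q⇒∁p⊇∁q; p⊆p∪q; q⊆p∪q; x∈p∪q⁻; x∈p∪q⁺; p─q⊆p; x∈p∧x∉q⇒x∈p─q
        ; x∈p∧x≢y⇒x∈p-y; ∉⊥; ⊆-antisym; p⊂q⇒∣p∣<∣q∣; ∣p∣≤n )
open import Data.Vec using (_∷_; lookup; tabulate; here; there)
open import Data.Vec.Properties using (lookup∘tabulate; []=⇒lookup; lookup⇒[]=)
open import Data.List using (List; []; _∷_; map; foldr; concat; allFin)
open import Data.List.Relation.Unary.Any as Any using (Any; here; there)
open import Data.List.Membership.Propositional using () renaming (_∈_ to _∈ˡ_)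
open import Data.List.Membership.Propositional.Properties
  using (∈-allFin; ∈-map⁺; ∈-concat⁺′)
open import Data.Rational using (ℚ; 0ℚ; _+_; _≤_; _<_)
open import Data.Rational.Properties
  using (≤-refl; <⇒≤; <-irrefl; ≤-<-trans; +-mono-≤; +-mono-<-≤; +-mono-≤-<)
open import Data.Product using (_×_; _,_; proj₁; proj₂; Σ; ∃; ∃-syntax)
open import Data.Product.Properties using (≡-dec)
open import Data.Sum using (_⊎_; inj₁; inj₂)
open import Data.Empty using (⊥; ⊥-elim)
open import Relation.Nullary using (¬_; Dec; yes; no; does)
open import Relation.Nullary.Decidable using (_×-dec_; _⊎-dec_)
open import Relation.Binary.PropositionalEquality
  using (_≡_; _≢_; refl; trans; subst; cong; ≢-sym)
  renaming (sym to ≡-sym)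

x∈p─q⇒x∉q : ∀ {n} {x : Fin n} (p q : Subset n) → x ∈ p ─ q → x ∉ q
x∈p─q⇒x∉q (_ ∷ _) (inside ∷ _) () here
x∈p─q⇒x∉q (_ ∷ _) (outside ∷ _) here ()
x∈p─q⇒x∉q (_ ∷ p) (_ ∷ q) (there m) (there m′) = x∈p─q⇒x∉q p q m m′

x∈p-y⇒x≢y : ∀ {n} {x y : Fin n} (p : Subset n) → x ∈ p - y → x ≢ y
x∈p-y⇒x≢y {x = x} {y} p m x≡y = x∈p─q⇒x∉q p ⁅ y ⁆ m (subst (λ z → x ∈ ⁅ z ⁆) x≡y (x∈⁅x⁆ x))

∈full- : ∀ {n} {x y : Fin n} → x ≢ y → x ∈ full - y
∈full- x≢y = x∈p∧x≢y⇒x∈p-y (x∉p⇒x∈∁p ∉⊥) x≢y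

select : ∀ {n} {P : Fin n → Set} → (∀ x → Dec (P x)) → Subset n
select P? = tabulate (λ x → does (P? x))

select⁺ : ∀ {n} {P : Fin n → Set} (P? : ∀ x → Dec (P x)) {x} → P x → x ∈ select P?
select⁺ {P = P} P? {x} px = lookup⇒[]= x _ (trans (lookup∘tabulate _ x) (decided (P? x)))
  where
  decided : (d : Dec (P x)) → does d ≡ inside
  decided (yes _) = refl
  decided (no ¬px) = ⊥-elim (¬px px)

select⁻ : ∀ {n} {P : Fin n → Set} (P? : ∀ x → Dec (P x)) {x} → x ∈ select P? → P x
select⁻ {P = P} P? {x} m = witness (P? x) (trans (≡-sym (lookup∘tabulate _ x)) ([]=⇒lookup m))
  where
  witness : (d : Dec (P x)) → does d ≡ inside → P x
  witness (yes px) _ = px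

-- weight w S sums summand w S over all nodes; summand w S v is w v on S
-- and 0 elsewhere.  (Defs keeps the summand function local to weight, so it
-- is recovered by unification with the definition.)
private
  unfold-weight : ∀ {n} (w : Fin n → ℚ) (S : Subset n)
                  → Σ (Fin n → ℚ) λ f → weight w S ≡ foldr _+_ 0ℚ (map f (allFin n))
  unfold-weight w S = _ , refl

summand : ∀ {n} → (Fin n → ℚ) → Subset n → Fin n → ℚ
summand w S = proj₁ (unfold-weight w S)

summand-∈ : ∀ {n} (w : Fin n → ℚ) {S : Subset n} {v} → v ∈ S → summand w S v ≡ w v
summand-∈ w {S} {v} v∈S rewrite []=⇒lookup v∈S = refl

summand-∉ : ∀ {n} (w : Fin n → ℚ) {S : Subset n} {v} → v ∉ S → summand w S v ≡ 0ℚ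
summand-∉ w {S} {v} v∉S with lookup S v in eq
... | inside = ⊥-elim (v∉S (lookup⇒[]= v S eq))
... | outside = refl

sum-mono : {A : Set} (f g : A → ℚ) (xs : List A) → (∀ x → f x ≤ g x)
           → foldr _+_ 0ℚ (map f xs) ≤ foldr _+_ 0ℚ (map g xs)
sum-mono f g [] f≤g = ≤-refl
sum-mono f g (x ∷ xs) f≤g = +-mono-≤ (f≤g x) (sum-mono f g xs f≤g)

sum-strict : {A : Set} (f g : A → ℚ) (xs : List A) → (∀ x → f x ≤ g x)
             → ∀ {y} → y ∈ˡ xs → f y < g y
             → foldr _+_ 0ℚ (map f xs) < foldr _+_ 0ℚ (map g xs)
sum-strict f g (x ∷ xs) f≤g (here refl) fy<gy = +-mono-<-≤ fy<gy (sum-mono f g xs f≤g)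
sum-strict f g (x ∷ xs) f≤g (there y∈xs) fy<gy = +-mono-≤-< (f≤g x) (sum-strict f g xs f≤g y∈xs fy<gy)

weight-strict : ∀ {n} (w : Fin n → ℚ) → (∀ v → 0ℚ < w v)
                → ∀ {S′ S : Subset n} → S′ ⊆ S → ∀ {v} → v ∈ S → v ∉ S′
                → weight w S′ < weight w S
weight-strict {n} w pos {S′} {S} S′⊆S {v} v∈S v∉S′ =
  sum-strict (summand w S′) (summand w S) (allFin n) pointwise (∈-allFin v) strict
  where
  pointwise : ∀ u → summand w S′ u ≤ summand w S u
  pointwise u with u ∈? S′ | u ∈? S
  ... | yes u∈S′ | _ rewrite summand-∈ w u∈S′ | summand-∈ w (S′⊆S u∈S′) = ≤-refl
  ... | no u∉S′ | yes u∈S rewrite summand-∉ w u∉S′ | summand-∈ w u∈S = <⇒≤ (pos u)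
  ... | no u∉S′ | no u∉S rewrite summand-∉ w u∉S′ | summand-∉ w u∉S = ≤-refl

  strict : summand w S′ v < summand w S v
  strict rewrite summand-∉ w v∉S′ | summand-∈ w v∈S = pos v

module Walks {n} {G : Graph n} where

  walk-start : ∀ {S u v} → WalkIn G S u v → u ∈ S
  walk-start (here u∈S) = u∈S
  walk-start (step u∈S _ _) = u∈S

  widen : ∀ {S S′ u v} → S ⊆ S′ → WalkIn G S u v → WalkIn G S′ u v
  widen S⊆S′ (here u∈S) = here (S⊆S′ u∈S)
  widen S⊆S′ (step u∈S e W) = step (S⊆S′ u∈S) e (widen S⊆S′ W)

  _++ʷ_ : ∀ {S u v x} → WalkIn G S u v → WalkIn G S v x → WalkIn G S u x
  here _ ++ʷ W′ = W′
  step u∈S e W ++ʷ W′ = step u∈S e (W ++ʷ W′)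

  snoc : ∀ {S u v x} → WalkIn G S u v → Adj G v x → x ∈ S → WalkIn G S u x
  snoc (here v∈S) e x∈S = step v∈S e (here x∈S)
  snoc (step u∈S e′ W) e x∈S = step u∈S e′ (snoc W e x∈S)

  reverse : ∀ {S u v} → WalkIn G S u v → WalkIn G S v u
  reverse (here u∈S) = here u∈S
  reverse (step u∈S e W) = snoc (reverse W) (sym G e) u∈S

open Walks public

map-walk : ∀ {n} {G H : Graph n} → (∀ {u v} → Adj G u v → Adj H u v)
           → ∀ {S u v} → WalkIn G S u v → WalkIn H S u v
map-walk f (here u∈S) = here u∈S
map-walk f (step u∈S e W) = step u∈S (f e) (map-walk f W)

map-connected : ∀ {n} {G H : Graph n} → (∀ {u v} → Adj G u v → Adj H u v)
                → ∀ {S} → Connected G S → Connected H S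
map-connected f (nonempty , walk) = nonempty , λ u v u∈S v∈S → map-walk f (walk u v u∈S v∈S)

hub-connected : ∀ {n} {G : Graph n} {S : Subset n} (h : Fin n) → h ∈ S
                → (∀ {u} → u ∈ S → WalkIn G S u h) → Connected G S
hub-connected h h∈S to-h = (h , h∈S) , λ u v u∈S v∈S → to-h u∈S ++ʷ reverse (to-h v∈S)

attach : ∀ {n} {G : Graph n} {D E : Subset n} → Connected G D → D ⊆ E
         → (∀ {u} → u ∈ E → ∃[ d ] (d ∈ D × WalkIn G E u d)) → Connected G E
attach {G = G} {D} {E} ((h , h∈D) , walk) D⊆E reach = hub-connected h (D⊆E h∈D) to-h
  where
  to-h : ∀ {u} → u ∈ E → WalkIn G E u h
  to-h u∈E with reach u∈E
  ... | d , d∈D , W = W ++ʷ widen D⊆E (walk d h d∈D h∈D)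

Closed : ∀ {n} → Graph n → Subset n → Subset n → Set
Closed G K T = ∀ {a b} → a ∈ K → Adj G a b → b ∈ T → b ∈ K

module _ {n} {G : Graph n} {K T : Subset n} (closed : Closed G K T) where

  stays : ∀ {u v} → WalkIn G T u v → u ∈ K → v ∈ K
  stays (here _) u∈K = u∈K
  stays (step _ e W) u∈K = stays W (closed u∈K e (walk-start W))

  avoids : ∀ {u v} → WalkIn G T u v → u ∉ K → WalkIn G (T ─ K) u v
  avoids (here u∈T) u∉K = here (x∈p∧x∉q⇒x∈p─q u∈T u∉K)
  avoids (step u∈T e W) u∉K =
    step (x∈p∧x∉q⇒x∈p─q u∈T u∉K) e (avoids W λ v∈K → u∉K (closed v∈K (sym G e) u∈T))

record Exit {n} (G : Graph n) (S′ Q : Subset n) (u : Fin n) : Set where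
  constructor exit
  field
    {last next} : Fin n
    before : WalkIn G S′ u last
    edge : Adj G last next
    lands : next ∈ Q

first-exit : ∀ {n} {G : Graph n} {S S′ : Subset n} (Q : Subset n)
             → (∀ {x} → x ∈ S → x ∉ Q → x ∈ S′)
             → ∀ {u v} → WalkIn G S u v → v ∈ Q → u ∈ Q ⊎ Exit G S′ Q u
first-exit Q into (here _) v∈Q = inj₁ v∈Q
first-exit Q into {u} (step u∈S e W) v∈Q with u ∈? Q
... | yes u∈Q = inj₁ u∈Q
... | no u∉Q with first-exit Q into W v∈Q
...   | inj₁ u′∈Q = inj₂ (exit (here (into u∈S u∉Q)) e u′∈Q)
...   | inj₂ (exit W′ e′ lands) = inj₂ (exit (step (into u∈S u∉Q) e W′) e′ lands)

-- Any finite collection of connected sets of G stays connected in a subgraph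
-- of G with decidable adjacency: keep only the edges of the witnessing walks.
record DecidableSkeleton {n} (G : Graph n) (Ss : List (∃ (Connected G))) : Set₁ where
  field
    H : Graph n
    adj? : ∀ u v → Dec (Adj H u v)
    H⊆G : ∀ {u v} → Adj H u v → Adj G u v
    connected : ∀ {S c} → (S , c) ∈ˡ Ss → Connected H S

module Skeleton {n} (G : Graph n) where

  Edge : Set
  Edge = Σ (Fin n × Fin n) λ e → Adj G (proj₁ e) (proj₂ e)

  Listed : List Edge → Fin n → Fin n → Set
  Listed L u v = Any (λ e → proj₁ e ≡ (u , v)) L

  listed? : ∀ L u v → Dec (Listed L u v)
  listed? L u v = Any.any? (λ e → ≡-dec _≟_ _≟_ (proj₁ e) (u , v)) L

  listed⇒adj : ∀ {L u v} → Listed L u v → Adj G u v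
  listed⇒adj (here {x = _ , e} refl) = e
  listed⇒adj (there l) = listed⇒adj l

  spanned : List Edge → Graph n
  spanned L = record
    { Adj = λ u v → Listed L u v ⊎ Listed L v u
    ; sym = λ { (inj₁ l) → inj₂ l ; (inj₂ l) → inj₁ l }
    ; irrefl = λ { (inj₁ l) → irrefl G (listed⇒adj l) ; (inj₂ l) → irrefl G (listed⇒adj l) }
    }

  spanned? : ∀ L u v → Dec (Adj (spanned L) u v)
  spanned? L u v = listed? L u v ⊎-dec listed? L v u

  spanned⊆G : ∀ {L u v} → Adj (spanned L) u v → Adj G u v
  spanned⊆G (inj₁ l) = listed⇒adj l
  spanned⊆G (inj₂ l) = sym G (listed⇒adj l)

  edges : ∀ {S u v} → WalkIn G S u v → List Edge
  edges (here _) = []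
  edges (step {u} {v} _ e W) = ((u , v) , e) ∷ edges W

  lift : ∀ {L S u v} (W : WalkIn G S u v) → (∀ {e} → e ∈ˡ edges W → e ∈ˡ L)
         → WalkIn (spanned L) S u v
  lift (here u∈S) _ = here u∈S
  lift (step u∈S e W) ⊆L =
    step u∈S (inj₁ (Any.map (λ e≡ → cong proj₁ (≡-sym e≡)) (⊆L (here refl))))
         (lift W (λ m → ⊆L (there m)))

  spoke : ∀ {S} → Connected G S → (u : Fin n) → Dec (u ∈ S) → List Edge
  spoke ((h , h∈S) , walk) u (yes u∈S) = edges (walk u h u∈S h∈S)
  spoke _ u (no _) = []

  spokes : ∀ {S} → Connected G S → List Edge
  spokes {S} c = concat (map (λ u → spoke c u (u ∈? S)) (allFin n))

  lift-connected : ∀ {L S} (c : Connected G S) → (∀ {e} → e ∈ˡ spokes c → e ∈ˡ L)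
                   → Connected (spanned L) S
  lift-connected {L} {S} c@((h , h∈S) , walk) ⊆L = hub-connected h h∈S to-h
    where
    to-h : ∀ {u} → u ∈ S → WalkIn (spanned L) S u h
    to-h {u} u∈S = lift-spoke (u ∈? S) (λ m → ⊆L (∈-concat⁺′ m (∈-map⁺ _ (∈-allFin u))))
      where
      lift-spoke : (d : Dec (u ∈ S)) → (∀ {e} → e ∈ˡ spoke c u d → e ∈ˡ L)
                   → WalkIn (spanned L) S u h
      lift-spoke (yes u∈S′) ⊆L′ = lift (walk u h u∈S′ h∈S) ⊆L′
      lift-spoke (no u∉S) _ = ⊥-elim (u∉S u∈S)

  skeleton : (Ss : List (∃ (Connected G))) → DecidableSkeleton G Ss
  skeleton Ss = record
    { H = spanned L ; adj? = spanned? L ; H⊆G = spanned⊆G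
    ; connected = λ {S} {c} m → lift-connected c (λ e∈ → ∈-concat⁺′ e∈ (∈-map⁺ (λ Sc → spokes (proj₂ Sc)) m))
    }
    where
    L : List Edge
    L = concat (map (λ Sc → spokes (proj₂ Sc)) Ss)

module Components {n} (H : Graph n) (adj? : ∀ u v → Dec (Adj H u v)) where

  record Component (T : Subset n) (r : Fin n) : Set where
    field
      nodes : Subset n
      root : r ∈ nodes
      within : nodes ⊆ T
      closed : Closed H nodes T
      to-root : ∀ {k} → k ∈ nodes → WalkIn H nodes k r

    connected : Connected H nodes
    connected = hub-connected r root to-root

  open Component public

  module Explore (T : Subset n) (r : Fin n) where

    record Partial (K : Subset n) : Set where
      field
        root : r ∈ K
        within : K ⊆ T
        to-root : ∀ {k} → k ∈ K → WalkIn H K k r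

    Frontier : Subset n → Fin n → Set
    Frontier K b = b ∈ T × ∃[ a ] (a ∈ K × Adj H a b)

    frontier? : ∀ K b → Dec (Frontier K b)
    frontier? K b = (b ∈? T) ×-dec any? (λ a → (a ∈? K) ×-dec adj? a b)

    grow : Subset n → Subset n
    grow K = K ∪ select (frontier? K)

    grow-partial : ∀ {K} → Partial K → Partial (grow K)
    grow-partial {K} P = record { root = p⊆p∪q _ (Partial.root P) ; within = within′ ; to-root = to-root′ }
      where
      K⊆ : K ⊆ grow K
      K⊆ = p⊆p∪q _
      within′ : grow K ⊆ T
      within′ m with x∈p∪q⁻ K _ m
      ... | inj₁ k = Partial.within P k
      ... | inj₂ f = proj₁ (select⁻ (frontier? K) f)
      to-root′ : ∀ {k} → k ∈ grow K → WalkIn H (grow K) k r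
      to-root′ m with x∈p∪q⁻ K _ m
      ... | inj₁ k = widen K⊆ (Partial.to-root P k)
      ... | inj₂ f with select⁻ (frontier? K) f
      ...   | _ , a , a∈K , e = step m (sym H e) (widen K⊆ (Partial.to-root P a∈K))

    explore : ∀ K → Partial K → Acc _<ℕ_ (n ∸ ∣ K ∣) → Component T r
    explore K P (acc smaller) with K ⊂? grow K
    ... | yes K⊂ = explore (grow K) (grow-partial P)
                     (smaller (∸-monoʳ-< (p⊂q⇒∣p∣<∣q∣ K⊂) (∣p∣≤n (grow K))))
    ... | no K⊄ = record
      { nodes = K ; root = Partial.root P ; within = Partial.within P
      ; closed = closed′ ; to-root = Partial.to-root P }
      where
      closed′ : Closed H K T
      closed′ {a} {b} a∈K e b∈T with b ∈? K
      ... | yes b∈K = b∈K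
      ... | no b∉K = ⊥-elim (K⊄ (p⊆p∪q _ , b , q⊆p∪q K _ (select⁺ (frontier? K) (b∈T , a , a∈K , e)) , b∉K))

  component : ∀ T r → r ∈ T → Component T r
  component T r r∈T = Explore.explore T r ⁅ r ⁆ start (<-wellFounded _)
    where
    start : Explore.Partial T r ⁅ r ⁆
    start = record
      { root = x∈⁅x⁆ r
      ; within = λ m → subst (_∈ T) (≡-sym (x∈⁅y⁆⇒x≡y r m)) r∈T
      ; to-root = λ m → subst (λ k → WalkIn H ⁅ r ⁆ k r) (≡-sym (x∈⁅y⁆⇒x≡y r m)) (here (x∈⁅x⁆ r)) }

InclusionMinimal : ∀ {n} → Graph n → Fin n → Fin n → Subset n → Set
InclusionMinimal G s t B = ∀ B′ → B′ ⊆ B → IsNSC G s t B′ → B ⊆ B′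

module EndNode {n} (H : Graph n) (adj? : ∀ u v → Dec (Adj H u v))
  {B : Subset n} {s t : Fin n} (s∈B : s ∈ B) (t∈B : t ∈ B) (s≢t : s ≢ t)
  (B-connected : Connected H B) (∁B-connected : Connected H (∁ B))
  (cut-free : ∀ x → Connected H (full - x))
  (minimal : InclusionMinimal H s t B) where

  open Components H adj?

  OutNeighbour : Fin n → Set
  OutNeighbour u = ∃[ c ] (c ∈ ∁ B × Adj H u c)

  c₀ : Fin n
  c₀ = proj₁ (proj₁ ∁B-connected)

  c₀∈∁B : c₀ ∈ ∁ B
  c₀∈∁B = proj₂ (proj₁ ∁B-connected)

  ∉∁B : ∀ {x} → x ∈ B → x ∉ ∁ B
  ∉∁B x∈B x∈∁B = x∈∁p⇒x∉p x∈∁B x∈B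

  c₀≢ : ∀ {x} → x ∈ B → c₀ ≢ x
  c₀≢ x∈B refl = ∉∁B x∈B c₀∈∁B

  inside-B : ∀ x {y} → y ∈ full - x → y ∉ ∁ B → y ∈ B - x
  inside-B x y∈ y∉∁B = x∈p∧x≢y⇒x∈p-y (x∉∁p⇒x∈p y∉∁B) (x∈p-y⇒x≢y full y∈)

  cut∉ : ∀ {x r} (C : Component (B - x) r) → x ∉ nodes C
  cut∉ {x} C x∈C = x∈p-y⇒x≢y B (within C x∈C) refl

  -- A connected X ⊆ B containing s and t is all of B, provided every node
  -- of B outside X reaches ∁B without entering X (which makes ∁ X connected).
  fills : ∀ {X} → X ⊆ B → s ∈ X → t ∈ X → Connected H X
          → (∀ {u} → u ∈ B → u ∉ X → ∃[ d ] (d ∈ ∁ B × WalkIn H (∁ X) u d))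
          → B ⊆ X
  fills {X} X⊆B s∈X t∈X X-connected escape =
    minimal X X⊆B (s∈X , t∈X , X-connected , attach ∁B-connected (p⊆q⇒∁p⊇∁q X⊆B) reach)
    where
    reach : ∀ {u} → u ∈ ∁ X → ∃[ d ] (d ∈ ∁ B × WalkIn H (∁ X) u d)
    reach {u} u∈∁X with u ∈? B
    ... | yes u∈B = escape u∈B (x∈∁p⇒x∉p u∈∁X)
    ... | no u∉B = u , x∉p⇒x∈∁p u∉B , here u∈∁X

  to-cut : ∀ {x r u} (C : Component (B - x) r) → x ∈ B → u ∈ B → u ∉ nodes C
           → WalkIn H (B ─ nodes C) u x
  to-cut {x} {u = u} C x∈B u∈B u∉C
    with first-exit ⁅ x ⁆ x∈p∧x∉q⇒x∈p─q (proj₂ B-connected u x u∈B x∈B) (x∈⁅x⁆ x)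
  ... | inj₁ u∈⁅x⁆ =
    subst (λ y → WalkIn H (B ─ nodes C) y x) (≡-sym (x∈⁅y⁆⇒x≡y x u∈⁅x⁆))
          (here (x∈p∧x∉q⇒x∈p─q x∈B (cut∉ C)))
  ... | inj₂ (exit before e lands) =
    snoc (widen forget-x (avoids (closed C) before u∉C))
         (subst (Adj H _) (x∈⁅y⁆⇒x≡y x lands) e) (x∈p∧x∉q⇒x∈p─q x∈B (cut∉ C))
    where
    forget-x : B - x ─ nodes C ⊆ B ─ nodes C
    forget-x m = x∈p∧x∉q⇒x∈p─q (p─q⊆p B ⁅ x ⁆ (p─q⊆p _ (nodes C) m)) (x∈p─q⇒x∉q _ (nodes C) m)

  -- (A) B - s is connected: it is the component Kt of t in B - s, since
  -- Kt ∪ {s} is an st-NSC inside B.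
  module Removal where

    Kt : Component (B - s) t
    Kt = component (B - s) t (x∈p∧x≢y⇒x∈p-y t∈B (≢-sym s≢t))

    B′ : Subset n
    B′ = nodes Kt ∪ ⁅ s ⁆

    B′⊆B : B′ ⊆ B
    B′⊆B m with x∈p∪q⁻ (nodes Kt) _ m
    ... | inj₁ k = p─q⊆p B _ (within Kt k)
    ... | inj₂ u∈⁅s⁆ = subst (_∈ B) (≡-sym (x∈⁅y⁆⇒x≡y s u∈⁅s⁆)) s∈B

    -- s has a neighbour in Kt: walk in B from t until the first visit of s.
    s-meets-Kt : ∃[ z ] (z ∈ nodes Kt × Adj H s z)
    s-meets-Kt with first-exit ⁅ s ⁆ x∈p∧x∉q⇒x∈p─q (proj₂ B-connected t s t∈B s∈B) (x∈⁅x⁆ s)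
    ... | inj₁ t∈⁅s⁆ = ⊥-elim (s≢t (≡-sym (x∈⁅y⁆⇒x≡y s t∈⁅s⁆)))
    ... | inj₂ (exit before e lands) =
      _ , stays (closed Kt) before (root Kt) , sym H (subst (Adj H _) (x∈⁅y⁆⇒x≡y s lands) e)

    B′-connected : Connected H B′
    B′-connected = attach (connected Kt) (p⊆p∪q _) reach
      where
      reach : ∀ {u} → u ∈ B′ → ∃[ d ] (d ∈ nodes Kt × WalkIn H B′ u d)
      reach {u} m with x∈p∪q⁻ (nodes Kt) _ m
      ... | inj₁ u∈Kt = u , u∈Kt , here m
      ... | inj₂ u∈⁅s⁆ with x∈⁅y⁆⇒x≡y s u∈⁅s⁆ | s-meets-Kt
      ...   | refl | z , z∈Kt , e = z , z∈Kt , step m e (here (p⊆p∪q _ z∈Kt))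

    -- A node of B outside B′ walks to ∁B in G - s; up to its exit from B
    -- the walk stays in B - s, hence outside the closed set Kt.
    escape : ∀ {u} → u ∈ B → u ∉ B′ → ∃[ d ] (d ∈ ∁ B × WalkIn H (∁ B′) u d)
    escape {u} u∈B u∉B′
      with first-exit (∁ B) (inside-B s)
             (proj₂ (cut-free s) u c₀ (∈full- u≢s) (∈full- (c₀≢ s∈B))) c₀∈∁B
      where
      u≢s : u ≢ s
      u≢s u≡s = u∉B′ (q⊆p∪q (nodes Kt) _ (subst (λ y → u ∈ ⁅ y ⁆) u≡s (x∈⁅x⁆ u)))
    ... | inj₁ u∈∁B = ⊥-elim (∉∁B u∈B u∈∁B)
    ... | inj₂ (exit before e lands) =
      _ , lands , snoc (widen leave (avoids (closed Kt) before u∉Kt)) e (p⊆q⇒∁p⊇∁q B′⊆B lands)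
      where
      u∉Kt : u ∉ nodes Kt
      u∉Kt k = u∉B′ (p⊆p∪q _ k)
      leave : B - s ─ nodes Kt ⊆ ∁ B′
      leave m = x∉p⇒x∈∁p λ m′ → case-B′ m (x∈p∪q⁻ (nodes Kt) _ m′)
        where
        case-B′ : ∀ {y} → y ∈ B - s ─ nodes Kt → y ∈ nodes Kt ⊎ y ∈ ⁅ s ⁆ → ⊥
        case-B′ m (inj₁ k) = x∈p─q⇒x∉q _ (nodes Kt) m k
        case-B′ m (inj₂ y∈⁅s⁆) = x∈p-y⇒x≢y B (p─q⊆p _ (nodes Kt) m) (x∈⁅y⁆⇒x≡y s y∈⁅s⁆)

    B-s⊆Kt : B - s ⊆ nodes Kt
    B-s⊆Kt m with x∈p∪q⁻ (nodes Kt) _ (B⊆B′ (p─q⊆p B _ m))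
      where
      B⊆B′ : B ⊆ B′
      B⊆B′ = fills B′⊆B (q⊆p∪q (nodes Kt) _ (x∈⁅x⁆ s)) (p⊆p∪q _ (root Kt)) B′-connected escape
    ... | inj₁ k = k
    ... | inj₂ u∈⁅s⁆ = ⊥-elim (x∈p-y⇒x≢y B m (x∈⁅y⁆⇒x≡y s u∈⁅s⁆))

  end-removable : Connected H (B - s)
  end-removable = subst (Connected H) (⊆-antisym (within Kt) B-s⊆Kt) (connected Kt)
    where open Removal

  -- (B) s has a neighbour outside B.  The side of x ≠ s is the component
  -- of s in B - x; descending through sides that miss t ends at s.
  side : ∀ x → x ≢ s → Component (B - x) s
  side x x≢s = component (B - x) s (x∈p∧x≢y⇒x∈p-y s∈B (≢-sym x≢s))

  side-touches : ∀ {x} → x ∈ B → (x≢s : x ≢ s)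
                 → ∃[ z ] (z ∈ nodes (side x x≢s) × OutNeighbour z)
  side-touches {x} x∈B x≢s
    with first-exit (∁ B) (inside-B x)
           (proj₂ (cut-free x) s c₀ (∈full- (≢-sym x≢s)) (∈full- (c₀≢ x∈B))) c₀∈∁B
  ... | inj₁ s∈∁B = ⊥-elim (∉∁B s∈B s∈∁B)
  ... | inj₂ (exit before e lands) =
    _ , stays (closed (side x x≢s)) before (root (side x x≢s)) , _ , lands , e

  -- A node z ≠ s of B with a neighbour outside B separates s from t in B:
  -- otherwise its side would be an st-NSC inside B missing z.
  separates : ∀ {z} → z ∈ B → (z≢s : z ≢ s) → OutNeighbour z → t ∉ nodes (side z z≢s)
  separates {z} z∈B z≢s (y , y∈∁B , e) t∈K = cut∉ K (B⊆K z∈B)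
    where
    K : Component (B - z) s
    K = side z z≢s
    K⊆B : nodes K ⊆ B
    K⊆B k = p─q⊆p B _ (within K k)
    escape : ∀ {u} → u ∈ B → u ∉ nodes K → ∃[ d ] (d ∈ ∁ B × WalkIn H (∁ (nodes K)) u d)
    escape u∈B u∉K =
      y , y∈∁B , snoc (widen (λ m → x∉p⇒x∈∁p (x∈p─q⇒x∉q B _ m)) (to-cut K z∈B u∈B u∉K))
                      e (p⊆q⇒∁p⊇∁q K⊆B y∈∁B)
    B⊆K : B ⊆ nodes K
    B⊆K = fills K⊆B (root K) t∈K (connected K) escape

  nested : ∀ {x z} → x ∈ B → (x≢s : x ≢ s) → t ∉ nodes (side x x≢s)
           → z ∈ nodes (side x x≢s) → (z≢s : z ≢ s) → t ∉ nodes (side z z≢s)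
           → nodes (side z z≢s) ⊂ nodes (side x x≢s)
  nested {x} {z} x∈B x≢s t∉Kx z∈Kx z≢s t∉Kz = Kz⊆Kx , z , z∈Kx , cut∉ Kz
    where
    Kx : Component (B - x) s
    Kx = side x x≢s
    Kz : Component (B - z) s
    Kz = side z z≢s
    -- t reaches x in B outside Kx, hence avoiding z; so x ∉ Kz as t ∉ Kz.
    avoid-z : B ─ nodes Kx ⊆ B - z
    avoid-z m = x∈p∧x≢y⇒x∈p-y (p─q⊆p B _ m)
                  (λ y≡z → x∈p─q⇒x∉q B _ m (subst (_∈ nodes Kx) (≡-sym y≡z) z∈Kx))
    x∉Kz : x ∉ nodes Kz
    x∉Kz x∈Kz = t∉Kz (stays (closed Kz) (reverse (widen avoid-z (to-cut Kx x∈B t∈B t∉Kx))) x∈Kz)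
    -- so Kz is a connected part of B - x containing s.
    Kz⊆B-x : nodes Kz ⊆ B - x
    Kz⊆B-x k = x∈p∧x≢y⇒x∈p-y (p─q⊆p B _ (within Kz k))
                 (λ y≡x → x∉Kz (subst (_∈ nodes Kz) y≡x k))
    Kz⊆Kx : nodes Kz ⊆ nodes Kx
    Kz⊆Kx k = stays (closed Kx) (reverse (widen Kz⊆B-x (to-root Kz k))) (root Kx)

  descend : ∀ {x} → x ∈ B → (x≢s : x ≢ s) → t ∉ nodes (side x x≢s)
            → Acc _<ℕ_ ∣ nodes (side x x≢s) ∣ → OutNeighbour s
  descend x∈B x≢s t∉Kx (acc smaller) with side-touches x∈B x≢s
  ... | z , z∈Kx , out with z ≟ s
  ...   | yes refl = out
  ...   | no z≢s = descend z∈B z≢s t∉Kz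
                     (smaller (p⊂q⇒∣p∣<∣q∣ (nested x∈B x≢s t∉Kx z∈Kx z≢s t∉Kz)))
    where
    z∈B : _ ∈ B
    z∈B = p─q⊆p B _ (within (side _ x≢s) z∈Kx)
    t∉Kz : t ∉ nodes (side _ z≢s)
    t∉Kz = separates z∈B z≢s out

  end-attached : OutNeighbour s
  end-attached = descend t∈B t≢s (cut∉ (side t t≢s)) (<-wellFounded _)
    where
    t≢s : t ≢ s
    t≢s = ≢-sym s≢t

  end-movable : Movable H B s
  end-movable = s∈B , end-removable , attach ∁B-connected (λ m → x∈p∪q⁺ (inj₁ m)) reach
    where
    reach : ∀ {u} → u ∈ ∁ B ∪ ⁅ s ⁆ → ∃[ d ] (d ∈ ∁ B × WalkIn H (∁ B ∪ ⁅ s ⁆) u d)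
    reach {u} m with x∈p∪q⁻ (∁ B) _ m
    ... | inj₁ u∈∁B = u , u∈∁B , here m
    ... | inj₂ u∈⁅s⁆ with x∈⁅y⁆⇒x≡y s u∈⁅s⁆ | end-attached
    ...   | refl | c , c∈∁B , e = c , c∈∁B , step m e (here (x∈p∪q⁺ (inj₁ c∈∁B)))

min⇒inclusion-minimal : ∀ {n} {G : Graph n} {w : Fin n → ℚ} {s t B} → (∀ v → 0ℚ < w v)
                        → IsMinNSC G w s t B → InclusionMinimal G s t B
min⇒inclusion-minimal {w = w} pos (_ , lightest) B′ B′⊆B nsc {v} v∈B with v ∈? B′
... | yes v∈B′ = v∈B′
... | no v∉B′ =
  ⊥-elim (<-irrefl refl (≤-<-trans (lightest B′ nsc) (weight-strict w pos B′⊆B v∈B v∉B′)))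

swap-ends : ∀ {n} {G : Graph n} {s t B} → IsNSC G s t B → IsNSC G t s B
swap-ends (s∈B , t∈B , connected) = t∈B , s∈B , connected

swap-minimal : ∀ {n} {G : Graph n} {s t B} → InclusionMinimal G s t B → InclusionMinimal G t s B
swap-minimal minimal B′ B′⊆B nsc = minimal B′ B′⊆B (swap-ends nsc)

map-movable : ∀ {n} {G H : Graph n} → (∀ {u v} → Adj H u v → Adj G u v)
              → ∀ {B v} → Movable H B v → Movable G B v
map-movable H⊆G (v∈B , removed , added) = v∈B , map-connected H⊆G removed , map-connected H⊆G added

-- An end node of an inclusion-minimal st-NSC of a biconnected graph is
-- movable: run EndNode in a decidable skeleton of G and transport back.
end-node-movable : ∀ {n} {G : Graph n} {s t B} → Biconnected G → IsNSC G s t B → s ≢ t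
                   → InclusionMinimal G s t B → Movable G B s
end-node-movable {n} {G} {s} {t} {B} (_ , cut-free) (s∈B , t∈B , B-connected , ∁B-connected) s≢t minimal =
  map-movable H⊆G
    (EndNode.end-movable H adj? s∈B t∈B s≢t (connected (here refl)) (connected (there (here refl)))
       (λ x → connected (there (there (∈-map⁺ _ (∈-allFin x))))) minimal-H)
  where
  open DecidableSkeleton
    (Skeleton.skeleton G ((B , B-connected) ∷ (∁ B , ∁B-connected)
                          ∷ map (λ x → full - x , cut-free x) (allFin n)))
  minimal-H : InclusionMinimal H s t B
  minimal-H B′ B′⊆B (s∈B′ , t∈B′ , B′-connected , ∁B′-connected) =
    minimal B′ B′⊆B (s∈B′ , t∈B′ , map-connected H⊆G B′-connected , map-connected H⊆G ∁B′-connected)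

-- An inner node v is not movable: B - v would be an st-NSC inside B.
inner-not-movable : ∀ {n} {G : Graph n} {s t B} → IsNSC G s t B → InclusionMinimal G s t B
                    → ∀ v → v ∈ B → v ≢ s → v ≢ t → ¬ Movable G B v
inner-not-movable {G = G} {s} {t} {B} (s∈B , t∈B , _) minimal v v∈B v≢s v≢t (_ , B-v-connected , rest-connected) =
  x∈p-y⇒x≢y B (minimal (B - v) (p─q⊆p B _) nsc v∈B) refl
  where
  rest≡ : ∁ B ∪ ⁅ v ⁆ ≡ ∁ (B - v)
  rest≡ = ⊆-antisym to from
    where
    to : ∁ B ∪ ⁅ v ⁆ ⊆ ∁ (B - v)
    to m with x∈p∪q⁻ (∁ B) _ m
    ... | inj₁ u∈∁B = p⊆q⇒∁p⊇∁q (p─q⊆p B _) u∈∁B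
    ... | inj₂ u∈⁅v⁆ = x∉p⇒x∈∁p λ u∈B-v → x∈p-y⇒x≢y B u∈B-v (x∈⁅y⁆⇒x≡y v u∈⁅v⁆)
    from : ∁ (B - v) ⊆ ∁ B ∪ ⁅ v ⁆
    from {u} m with u ≟ v
    ... | yes refl = x∈p∪q⁺ (inj₂ (x∈⁅x⁆ u))
    ... | no u≢v = x∈p∪q⁺ (inj₁ (x∉p⇒x∈∁p λ u∈B → x∈∁p⇒x∉p m (x∈p∧x≢y⇒x∈p-y u∈B u≢v)))
  nsc : IsNSC G s t (B - v)
  nsc = x∈p∧x≢y⇒x∈p-y s∈B (≢-sym v≢s) , x∈p∧x≢y⇒x∈p-y t∈B (≢-sym v≢t)
      , B-v-connected , subst (Connected G) rest≡ rest-connected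

lemma1 : ∀ {n} (G : Graph n) (w : Fin n → ℚ) (s t : Fin n) (B : Subset n)
         → Biconnected G
         → (∀ v → 0ℚ < w v)
         → s ≢ t
         → IsMinNSC G w s t B
         → Movable G B s × Movable G B t
           × (∀ v → v ∈ B → v ≢ s → v ≢ t → ¬ Movable G B v)
lemma1 G w s t B biconnected positive s≢t min-nsc@(nsc , _) =
    end-node-movable biconnected nsc s≢t minimal
  , end-node-movable biconnected (swap-ends nsc) (≢-sym s≢t) (swap-minimal minimal)
  , inner-not-movable nsc minimal
  where
  minimal : InclusionMinimal G s t B
  minimal = min⇒inclusion-minimal positive min-nsc
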